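{- Let $(a(n))_{n\ge1}$ be the sequence defined by $a(1)=2$ and, for $n\ge2$, $a(n)=a(n-1)+4$ if $n\in\{a(k):1\le k<n\}$ and $a(n)=a(n-1)+2$ otherwise. Then for every $n\ge1$, \[ -3< a(n)-(1+\sqrt3)\,n<2. \]
   Context: This sequence is the $(0,2,4,2)$-hiccup sequence (OEIS A284753), which begins $2,6,8,10,12,16,18,22,24,28,\ldots$. -}

module Defs where

open import Data.Nat using (ℕ; zero; suc; _+_; _*_)
open import Data.Nat.Properties using (_≟_)
open import Data.List using (List; []; _∷_)
open import Data.List.Membership.DecPropositional _≟_ using (_∈?_)
open import Data.Integer using (ℤ; +_; 0ℤ) renaming (_<_ to _<ℤ_; _≤_ to _≤ℤ_; _*_ to _*ℤ_)
open import Data.Product using (_×_)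
open import Data.Sum using (_⊎_)
open import Relation.Nullary using (does)
open import Data.Bool using (if_then_else_)

-- prefix n = [a(n), a(n-1), ..., a(1)]  (the first n terms, newest first).
-- a(1) = 2;  a(n) = a(n-1) + 4 if n ∈ {a(k) : 1 ≤ k < n}, else a(n-1) + 2.
prefix : ℕ → List ℕ
prefix zero = []
prefix (suc zero) = 2 ∷ []
prefix (suc (suc m)) with prefix (suc m)
... | [] = []   -- unreachable: prefix (suc m) is nonempty
... | p ∷ ps =
  (if does (suc (suc m) ∈? (p ∷ ps)) then p + 4 else p + 2) ∷ p ∷ ps

-- a n = a(n) for n ≥ 1 (a 0 = 0 is a junk value, never used).
a : ℕ → ℕ
a n with prefix n
... | [] = 0
... | p ∷ _ = p

-- Comparisons of an integer with the real number √3 · n (n ≥ 0),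
-- written out without reals:
--   x < √3·n   ⇔  x < 0  or  x² < 3n²
--   √3·n < x   ⇔  x ≥ 0  and 3n² < x²
_<√3·_ : ℤ → ℕ → Set
x <√3· n = (x <ℤ 0ℤ) ⊎ (x *ℤ x <ℤ + (3 * n * n))

√3·_<_ : ℕ → ℤ → Set
√3· n < x = (0ℤ ≤ℤ x) × (+ (3 * n * n) <ℤ x *ℤ x)

module Submission where

-- Every term a(k) ≤ m has turned one step +2 into +4, so a(m) = 2m + 2K with K = #{k ≥ 1 : a(k) ≤ m}.
-- Both bounds are proved together by strong induction, in the sharper form
-- √3(n − 1) < a(n) − (n − 1) and a(n) − n − 2 < √3 n: the upper bound at n comes from the lower bound
-- at K and the lower bound at n from the upper bound at K + 1, because the map v/u ↦ (v + 3u)/(u + v)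
-- exchanges the two sides of √3, as 3(u + v)² − (v + 3u)² = 2(v² − 3u²). Since √3 < 2, the sharper
-- lower bound gives a(n) − n + 3 > √3 n.

module Sqrt3 where
  open import Data.Nat
  open import Data.Nat.Properties
  open import Data.Nat.Tactic.RingSolver using (solve-∀)
  open import Relation.Binary.PropositionalEquality
  open import Relation.Nullary using (yes; no)

  infix 4 _<√3*_ √3*_<_

  _<√3*_ : ℕ → ℕ → Set
  x <√3* n = x * x < 3 * n * n

  √3*_<_ : ℕ → ℕ → Set
  √3* n < x = 3 * n * n < x * x

  ≤-<√3*-trans : ∀ {x y n} → x ≤ y → y <√3* n → x <√3* n
  ≤-<√3*-trans x≤y = ≤-<-trans (*-mono-≤ x≤y x≤y)

  √3*-<-≤-trans : ∀ {x y n} → √3* n < x → x ≤ y → √3* n < y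
  √3*-<-≤-trans h x≤y = <-≤-trans h (*-mono-≤ x≤y x≤y)

  m*m<n*n⇒m<n : ∀ {m n} → m * m < n * n → m < n
  m*m<n*n⇒m<n h = ≰⇒> λ n≤m → <⇒≱ h (*-mono-≤ n≤m n≤m)

  exchange-identity : ∀ u v →
    3 * (u + v) * (u + v) + 2 * (3 * u * u) ≡ (v + 3 * u) * (v + 3 * u) + 2 * (v * v)
  exchange-identity = solve-∀

  √3*u<v⇒v+3u<√3*[u+v] : ∀ u v → √3* u < v → v + 3 * u <√3* (u + v)
  √3*u<v⇒v+3u<√3*[u+v] u v h = +-cancelʳ-< (2 * (v * v)) _ _ (begin-strict
    (v + 3 * u) * (v + 3 * u) + 2 * (v * v)  ≡⟨ exchange-identity u v ⟨
    3 * (u + v) * (u + v) + 2 * (3 * u * u)  <⟨ +-monoʳ-< (3 * (u + v) * (u + v)) (*-monoʳ-< 2 h) ⟩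
    3 * (u + v) * (u + v) + 2 * (v * v)      ∎)
    where open ≤-Reasoning

  v<√3*u⇒√3*[u+v]<v+3u : ∀ u v → v <√3* u → √3* (u + v) < v + 3 * u
  v<√3*u⇒√3*[u+v]<v+3u u v h = +-cancelʳ-< (2 * (v * v)) _ _ (begin-strict
    3 * (u + v) * (u + v) + 2 * (v * v)      <⟨ +-monoʳ-< (3 * (u + v) * (u + v)) (*-monoʳ-< 2 h) ⟩
    3 * (u + v) * (u + v) + 2 * (3 * u * u)  ≡⟨ exchange-identity u v ⟩
    (v + 3 * u) * (v + 3 * u) + 2 * (v * v)  ∎)
    where open ≤-Reasoning

  √3*u<n∸u⇒n+2u<√3*n : ∀ u n → u ≤ n → √3* u < n ∸ u → n + 2 * u <√3* n
  √3*u<n∸u⇒n+2u<√3*n u n u≤n h =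
    subst (λ k → k + 2 * u <√3* k) (m+[n∸m]≡n u≤n)
      (subst (_<√3* (u + v)) (shift u v) (√3*u<v⇒v+3u<√3*[u+v] u v h))
    where
    v = n ∸ u
    shift : ∀ u v → v + 3 * u ≡ u + v + 2 * u
    shift = solve-∀

  n∸w<√3*w⇒√3*n<n+2w : ∀ n w → n ∸ w <√3* w → √3* n < n + 2 * w
  n∸w<√3*w⇒√3*n<n+2w n zero ()
  n∸w<√3*w⇒√3*n<n+2w n w@(suc _) h with n ≤? w
  ... | yes n≤w = begin-strict
    3 * n * n                  ≤⟨ *-mono-≤ (*-monoʳ-≤ 3 n≤w) n≤w ⟩
    3 * w * w                  <⟨ m<m+n (3 * w * w) z<s ⟩
    3 * w * w + w * w          ≡⟨ four w ⟩
    (2 * w) * (2 * w)          ≤⟨ *-mono-≤ (m≤n+m (2 * w) n) (m≤n+m (2 * w) n) ⟩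
    (n + 2 * w) * (n + 2 * w)  ∎
    where
    open ≤-Reasoning
    four : ∀ w → 3 * w * w + w * w ≡ (2 * w) * (2 * w)
    four = solve-∀
  ... | no n≰w =
    subst (λ k → √3* k < k + 2 * w) (m+[n∸m]≡n w≤n)
      (subst (√3* (w + s) <_) (shift w s) (v<√3*u⇒√3*[u+v]<v+3u w s h))
    where
    w≤n = <⇒≤ (≰⇒> n≰w)
    s = n ∸ w
    shift : ∀ w s → s + 3 * w ≡ w + s + 2 * w
    shift = solve-∀

  √3*p<x⇒√3*[1+p]<x+2 : ∀ p x → √3* p < x → √3* suc p < x + 2
  √3*p<x⇒√3*[1+p]<x+2 p x h = begin-strict
    3 * suc p * suc p              ≡⟨ expand-left p ⟩
    3 * p * p + 2 * (3 * p) + 3    <⟨ +-monoˡ-< 3 (+-mono-<-≤ h (*-monoʳ-≤ 2 3p≤2x)) ⟩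
    x * x + 2 * (2 * x) + 3        ≤⟨ +-monoʳ-≤ (x * x + 2 * (2 * x)) (n≤1+n 3) ⟩
    x * x + 2 * (2 * x) + 4        ≡⟨ expand-right x ⟨
    (x + 2) * (x + 2)              ∎
    where
    open ≤-Reasoning
    expand-left : ∀ p → 3 * suc p * suc p ≡ 3 * p * p + 2 * (3 * p) + 3
    expand-left = solve-∀
    expand-right : ∀ x → (x + 2) * (x + 2) ≡ x * x + 2 * (2 * x) + 4
    expand-right = solve-∀
    3p≤2x : 3 * p ≤ 2 * x
    3p≤2x = <⇒≤ (m*m<n*n⇒m<n (begin-strict
      (3 * p) * (3 * p)  ≡⟨ nine p ⟩
      3 * (3 * p * p)    <⟨ *-monoʳ-< 3 h ⟩
      3 * (x * x)        ≤⟨ *-monoˡ-≤ (x * x) (n≤1+n 3) ⟩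
      4 * (x * x)        ≡⟨ four x ⟩
      (2 * x) * (2 * x)  ∎))
      where
      nine : ∀ p → (3 * p) * (3 * p) ≡ 3 * (3 * p * p)
      nine = solve-∀
      four : ∀ x → 4 * (x * x) ≡ (2 * x) * (2 * x)
      four = solve-∀

module Hiccup where
  open import Defs using (prefix; a)
  open Sqrt3
  open import Data.Nat
  open import Data.Nat.Properties
  open import Data.Nat.Induction using (<-rec)
  open import Data.Nat.Tactic.RingSolver using (solve-∀)
  open import Data.List using (_∷_)
  open import Data.List.Membership.DecPropositional _≟_ using (_∈_; _∉_; _∈?_)
  open import Data.List.Relation.Unary.Any using (here; there)
  open import Data.Product using (∃-syntax; _×_; _,_; proj₁; proj₂)
  open import Data.Sum using (inj₁; inj₂)
  open import Data.Bool using (if_then_else_)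
  open import Function using (_∘_)
  open import Relation.Nullary using (does; yes; no)
  open import Relation.Nullary.Decidable using (dec-true; dec-false)
  open import Relation.Binary.PropositionalEquality

  prefix-suc-cons : ∀ m → ∃[ x ] prefix (suc m) ≡ x ∷ prefix m
  prefix-suc-cons zero = 2 , refl
  prefix-suc-cons (suc k) with prefix (suc k) | prefix-suc-cons k
  ... | .(x ∷ prefix k) | x , refl = _ , refl

  prefix-suc : ∀ m → prefix (suc m) ≡ a (suc m) ∷ prefix m
  prefix-suc m with prefix (suc m) | prefix-suc-cons m
  ... | .(x ∷ prefix m) | x , refl = refl

  a-step : ∀ m → a (suc (suc m)) ≡
    (if does (suc (suc m) ∈? prefix (suc m)) then a (suc m) + 4 else a (suc m) + 2)
  a-step m with prefix (suc m) | prefix-suc-cons m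
  ... | .(x ∷ prefix m) | x , refl = refl

  a-step-∈ : ∀ m → suc (suc m) ∈ prefix (suc m) → a (suc (suc m)) ≡ a (suc m) + 4
  a-step-∈ m h = trans (a-step m) (cong (λ b → if b then a (suc m) + 4 else a (suc m) + 2) (dec-true (_ ∈? _) h))

  a-step-∉ : ∀ m → suc (suc m) ∉ prefix (suc m) → a (suc (suc m)) ≡ a (suc m) + 2
  a-step-∉ m h = trans (a-step m) (cong (λ b → if b then a (suc m) + 4 else a (suc m) + 2) (dec-false (_ ∈? _) h))

  a∈prefix : ∀ {j m} → 1 ≤ j → j ≤ m → a j ∈ prefix m
  a∈prefix {m = zero} (s≤s _) ()
  a∈prefix {m = suc m} 1≤j j≤1+m rewrite prefix-suc m with m≤n⇒m<n∨m≡n j≤1+m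
  ... | inj₁ j<1+m = there (a∈prefix 1≤j (≤-pred j<1+m))
  ... | inj₂ refl = here refl

  ∈prefix⇒term : ∀ {x m} → x ∈ prefix m → ∃[ j ] a j ≡ x
  ∈prefix⇒term {m = zero} ()
  ∈prefix⇒term {m = suc m} x∈ rewrite prefix-suc m with x∈
  ... | here x≡ = suc m , sym x≡
  ... | there x∈′ = ∈prefix⇒term {m = m} x∈′

  a+2≤a[1+m] : ∀ m → a m + 2 ≤ a (suc m)
  a+2≤a[1+m] zero = ≤-refl
  a+2≤a[1+m] (suc m) with suc (suc m) ∈? prefix (suc m)
  ... | yes h rewrite a-step-∈ m h = +-monoʳ-≤ (a (suc m)) (m≤m+n 2 2)
  ... | no h rewrite a-step-∉ m h = ≤-refl

  a-mono-≤ : ∀ {i j} → i ≤ j → a i ≤ a j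
  a-mono-≤ = mono′ ∘ ≤⇒≤′
    where
    mono′ : ∀ {i j} → i ≤′ j → a i ≤ a j
    mono′ ≤′-refl = ≤-refl
    mono′ {j = suc j} (≤′-step i≤′j) = ≤-trans (mono′ i≤′j) (≤-trans (m≤m+n (a j) 2) (a+2≤a[1+m] j))

  2n≤a : ∀ n → 2 * n ≤ a n
  2n≤a zero = z≤n
  2n≤a (suc n) = begin
    2 * suc n    ≡⟨ *-suc 2 n ⟩
    2 + 2 * n    ≤⟨ +-monoʳ-≤ 2 (2n≤a n) ⟩
    2 + a n      ≡⟨ +-comm 2 (a n) ⟩
    a n + 2      ≤⟨ a+2≤a[1+m] n ⟩
    a (suc n)    ∎
    where open ≤-Reasoning

  n<a : ∀ n → suc n < a (suc n)
  n<a n = <-≤-trans (m<m+n (suc n) z<s) (2n≤a (suc n))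

  between-consecutive⇒a≢ : ∀ {K x} → a K < x → x < a (suc K) → ∀ j → a j ≢ x
  between-consecutive⇒a≢ {K} aK<x x<aK+1 j refl with j ≤? K
  ... | yes j≤K = <-irrefl refl (<-≤-trans aK<x (a-mono-≤ j≤K))
  ... | no j≰K = <-irrefl refl (<-≤-trans x<aK+1 (a-mono-≤ (≰⇒> j≰K)))

  -- K = #{k ≥ 1 : a k ≤ suc m}; when K = 0 the first conjunct holds by the junk value a 0 = 0.
  a-count : ∀ m → ∃[ K ] a K ≤ suc m × suc m < a (suc K) × a (suc m) ≡ 2 * suc m + 2 * K
  a-count zero = 0 , z≤n , ≤-refl , refl
  a-count (suc m) with a-count m
  ... | K , aK≤ , <aK+1 , a≡ with m≤n⇒m<n∨m≡n <aK+1
  ... | inj₁ 2+m<aK+1 = K , m≤n⇒m≤1+n aK≤ , 2+m<aK+1 , (begin-equality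
    a (suc (suc m))             ≡⟨ a-step-∉ m not-term ⟩
    a (suc m) + 2               ≡⟨ cong (_+ 2) a≡ ⟩
    2 * suc m + 2 * K + 2       ≡⟨ count-∉ m K ⟩
    2 * suc (suc m) + 2 * K     ∎)
    where
    open ≤-Reasoning
    not-term : suc (suc m) ∉ prefix (suc m)
    not-term 2+m∈ with j , aj≡ ← ∈prefix⇒term {m = suc m} 2+m∈ =
      between-consecutive⇒a≢ {K} (s≤s aK≤) 2+m<aK+1 j aj≡
    count-∉ : ∀ m K → 2 * suc m + 2 * K + 2 ≡ 2 * suc (suc m) + 2 * K
    count-∉ = solve-∀
  ... | inj₂ 2+m≡aK+1 = suc K , ≤-reflexive (sym 2+m≡aK+1) , 2+m<aK+2 , (begin-equality
    a (suc (suc m))             ≡⟨ a-step-∈ m term ⟩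
    a (suc m) + 4               ≡⟨ cong (_+ 4) a≡ ⟩
    2 * suc m + 2 * K + 4       ≡⟨ count-∈ m K ⟩
    2 * suc (suc m) + 2 * suc K ∎)
    where
    open ≤-Reasoning
    term : suc (suc m) ∈ prefix (suc m)
    term = subst (_∈ prefix (suc m)) (sym 2+m≡aK+1)
      (a∈prefix (s≤s z≤n) (≤-pred (subst (suc K <_) (sym 2+m≡aK+1) (n<a K))))
    2+m<aK+2 : suc (suc m) < a (suc (suc K))
    2+m<aK+2 = subst (_< a (suc (suc K))) (sym 2+m≡aK+1)
      (<-≤-trans (m<m+n (a (suc K)) z<s) (a+2≤a[1+m] (suc K)))
    count-∈ : ∀ m K → 2 * suc m + 2 * K + 4 ≡ 2 * suc (suc m) + 2 * suc K
    count-∈ = solve-∀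

  m+m≤1+n⇒m≤n : ∀ m n → m + m ≤ suc n → m ≤ n
  m+m≤1+n⇒m≤n zero n _ = z≤n
  m+m≤1+n⇒m≤n (suc m) n h = ≤-trans (m≤n+m (suc m) m) (≤-pred h)

  Bounds : ℕ → Set
  Bounds n = √3* (n ∸ 1) < a n ∸ (n ∸ 1) × a n ∸ (2 + n) <√3* n

  a-bounds : ∀ p → Bounds (suc p)
  a-bounds = <-rec (λ p → Bounds (suc p)) step
    where
    step : ∀ p → (∀ {q} → q < p → Bounds (suc q)) → Bounds (suc p)
    step zero _ = <ᵇ⇒< 0 4 _ , <ᵇ⇒< 0 3 _
    step (suc zero) _ = <ᵇ⇒< 3 25 _ , <ᵇ⇒< 4 12 _
    step p@(suc (suc k)) bounds with a-count p
    ... | zero , _ , s≤s (s≤s ()) , _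
    ... | suc u , aK≤n , n<aw , a≡ = lower , upper
      where
      n = suc p
      w = suc (suc u)
      u≤k : u ≤ k
      u≤k = m+m≤1+n⇒m≤n u k (≤-pred (≤-pred (subst (_≤ n) (two-halves u) (≤-trans (2n≤a (suc u)) aK≤n))))
        where
        two-halves : ∀ u → 2 * suc u ≡ 2 + (u + u)
        two-halves = solve-∀
      upper : a n ∸ (2 + n) <√3* n
      upper = subst (_<√3* n) (sym (begin-equality
        a n ∸ (2 + n)                    ≡⟨ cong (_∸ (2 + n)) (trans a≡ (split u n)) ⟩
        n + 2 * u + (2 + n) ∸ (2 + n)    ≡⟨ m+n∸n≡m (n + 2 * u) (2 + n) ⟩
        n + 2 * u                        ∎))
        (√3*u<n∸u⇒n+2u<√3*n u n (≤-trans u≤k (m≤n+m k 3))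
          (√3*-<-≤-trans {n = u} (proj₁ (bounds (s≤s (m≤n⇒m≤1+n u≤k)))) (∸-monoˡ-≤ u aK≤n)))
        where
        open ≤-Reasoning
        split : ∀ u n → 2 * n + 2 * suc u ≡ n + 2 * u + (2 + n)
        split = solve-∀
      lower : √3* p < a n ∸ p
      lower = subst (√3* p <_) (sym (begin-equality
        a n ∸ p                ≡⟨ cong (_∸ p) (trans a≡ (split u p)) ⟩
        p + 2 * w + p ∸ p      ≡⟨ m+n∸n≡m (p + 2 * w) p ⟩
        p + 2 * w              ∎))
        (n∸w<√3*w⇒√3*n<n+2w p w
          (≤-<√3*-trans {n = w} (∸-monoˡ-≤ (2 + w) n<aw) (proj₂ (bounds (s≤s (s≤s u≤k))))))
        where
        open ≤-Reasoning
        split : ∀ u p → 2 * suc p + 2 * suc u ≡ p + 2 * suc (suc u) + p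
        split = solve-∀

open import Defs
open import Data.Nat as ℕ using (ℕ; suc; _≤_; _∸_)
import Data.Nat.Properties as ℕᴾ
open import Data.Integer as ℤ using (+_; _-_; _+_; _⊖_; +≤+; +<+)
import Data.Integer.Properties as ℤᴾ
open import Data.Integer.Tactic.RingSolver using (solve-∀)
open import Data.Product using (_×_; _,_; proj₁; proj₂)
open import Data.Sum using (inj₁; inj₂)
open import Relation.Nullary using (yes; no)
open import Relation.Binary.PropositionalEquality
open Sqrt3 using (_<√3*_; √3*_<_; √3*p<x⇒√3*[1+p]<x+2)
open Hiccup using (n<a; a-bounds)

√3*<⇒√3·<+ : ∀ n {x} → √3* n < x → √3· n < (+ x)
√3*<⇒√3·<+ n {x} h = +≤+ ℕ.z≤n , subst (+ (3 ℕ.* n ℕ.* n) ℤ.<_) (ℤᴾ.pos-* x x) (+<+ h)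

∸<√3*⇒⊖<√3· : ∀ x y n → x ∸ y <√3* n → (x ⊖ y) <√3· n
∸<√3*⇒⊖<√3· x y n h with y ℕ.≤? x
... | yes y≤x rewrite ℤᴾ.⊖-≥ y≤x =
  inj₂ (subst (ℤ._< + (3 ℕ.* n ℕ.* n)) (ℤᴾ.pos-* (x ∸ y) (x ∸ y)) (+<+ h))
... | no y≰x = inj₁ (subst (x ⊖ y ℤ.<_) (ℤᴾ.n⊖n≡0 y) (ℤᴾ.⊖-monoˡ-< y (ℕᴾ.≰⇒> y≰x)))

theorem17 : (n : ℕ) → 1 ≤ n →
    (√3· n < ((+ a n - + n) + + 3)) × (((+ a n - + n) - + 2) <√3· n)
theorem17 n@(suc p) _ = lower , upper
  where
  open ≡-Reasoning
  p≤a : p ≤ a n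
  p≤a = ℕᴾ.<⇒≤ (ℕᴾ.<-trans (ℕᴾ.n<1+n p) (n<a p))
  lower-shift : ∀ x y → (x - (ℤ.1ℤ + y)) + ℤ.+ 3 ≡ (x - y) + ℤ.+ 2
  lower-shift = solve-∀
  upper-shift : ∀ x y → (x - y) - ℤ.+ 2 ≡ x - (ℤ.+ 2 + y)
  upper-shift = solve-∀
  lower : √3· n < ((+ a n - + n) + + 3)
  lower = subst (√3· n <_) (sym (begin
    (+ a n - + n) + + 3   ≡⟨ lower-shift (+ a n) (+ p) ⟩
    (+ a n - + p) + + 2   ≡⟨ cong (_+ + 2) (trans (ℤᴾ.[+m]-[+n]≡m⊖n (a n) p) (ℤᴾ.⊖-≥ p≤a)) ⟩
    + (a n ∸ p) + + 2     ∎))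
    (√3*<⇒√3·<+ n (√3*p<x⇒√3*[1+p]<x+2 p (a n ∸ p) (proj₁ (a-bounds p))))
  upper : ((+ a n - + n) - + 2) <√3· n
  upper = subst (_<√3· n) (sym (trans (upper-shift (+ a n) (+ n)) (ℤᴾ.[+m]-[+n]≡m⊖n (a n) (2 ℕ.+ n))))
    (∸<√3*⇒⊖<√3· (a n) (2 ℕ.+ n) n (proj₂ (a-bounds p)))
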